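{- Let $r$ be a power of $2$, let $\ell=r+1$, and let $G$ and $P$ be the graph and critical path set defined below. Let $\sigma$ be any path of length $g\ge 1$ in $G$ from a vertex in layer $a$ to a vertex in layer $b$, where $a,b\in\langle \ell\rangle$ and $b-a=g$. Then at most $8r/g$ critical paths in $P$ contain $\sigma$ as a subpath.
   Context: For a nonnegative integer $N$, $\langle N\rangle=\{0,\dots,N-1\}$ and $[N]=\{1,\dots,N\}$. Let $r$ be a power of $2$ and let $q$ be the permutation of $\langle r\rangle$ such that the $(\log_2 r)$-bit binary representation of $q_i$ is the $(\log_2 r)$-bit binary representation of $i$ reversed. The directed graph $G$ has vertex set $\{(i,x_1,x_2): i\in\{0,\dots,r\},\ (x_1,x_2)\in\langle 2r\rangle\times\langle 2r^2\rangle\}$ ($i$ is the layer). For $i\in\langle r\rangle$ let $E_i=\{(1,q_i),(0,0)\}$; for every vertex $(i,x_1,x_2)$ with $i<r$ and every $(e_1,e_2)\in E_i$ with $(x_1+e_1,x_2+e_2)\in\langle 2r\rangle\times\langle 2r^2\rangle$ there is an edge from $(i,x_1,x_2)$ to $(i+1,x_1+e_1,x_2+e_2)$; there are no other edges. For each $(x_1,x_2)\in\langle r\rangle\times\langle r^2\rangle$ and each $s\in[r]$ there is a critical path: it starts at $(0,x_1,x_2)$ and, from layer $i$ to layer $i+1$, uses the edge corresponding to $(1,q_i)$ if $q_i<s$ and the edge corresponding to $(0,0)$ otherwise. $P$ is the set of all these critical paths. -}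

module Defs where

open import Data.Nat using (ℕ; zero; suc; _+_; _*_; _^_; _<_; _≤_; _<?_)
open import Data.Nat.DivMod using (_/_; _%_)
open import Data.Nat.Properties using () renaming (_≟_ to _≟ℕ_)
open import Data.Product using (_×_; _,_)
open import Data.Product.Properties using (≡-dec)
open import Data.Sum using (_⊎_)
open import Data.Fin using (Fin; toℕ; inject₁) renaming (suc to fsuc)
open import Data.Fin.Properties using (all?)
open import Data.List using (List; upTo; map; concatMap; filter; length)
open import Relation.Nullary using (Dec; yes; no)
open import Relation.Binary.PropositionalEquality using (_≡_)

-- r = 2 ^ k throughout.

bitrev : ℕ → ℕ → ℕ
bitrev zero    i = 0
bitrev (suc k) i = (i % 2) * 2 ^ k + bitrev k (i / 2)

q : ℕ → ℕ → ℕ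
q k i = bitrev k i

-- a vertex (i , x₁ , x₂): layer i, coordinates x₁ x₂
Vertex : Set
Vertex = ℕ × ℕ × ℕ

IsVertex : ℕ → Vertex → Set
IsVertex k (i , x₁ , x₂) = i ≤ 2 ^ k × x₁ < 2 * 2 ^ k × x₂ < 2 * (2 ^ k * 2 ^ k)

Edge : ℕ → Vertex → Vertex → Set
Edge k (i , x₁ , x₂) v =
  IsVertex k (i , x₁ , x₂) × IsVertex k v × i < 2 ^ k ×
  ((v ≡ (suc i , x₁ + 1 , x₂ + q k i)) ⊎ (v ≡ (suc i , x₁ , x₂)))

IsPath : ℕ → (g : ℕ) → (Fin (suc g) → Vertex) → Set
IsPath k g σ = (j : Fin g) → Edge k (σ (inject₁ j)) (σ (fsuc j))

-- offset accumulated by the critical path with parameter s after the first i steps: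
-- (number of j < i with q_j < s , sum of those q_j)
offset : ℕ → ℕ → ℕ → ℕ × ℕ
offset k s zero = (0 , 0)
offset k s (suc i) with offset k s i | q k i <? s
... | (c , t) | yes _ = (c + 1 , t + q k i)
... | (c , t) | no  _ = (c , t)

critVertex : ℕ → ℕ → ℕ → ℕ → ℕ → Vertex
critVertex k x₁ x₂ s i with offset k s i
... | (c , t) = (i , x₁ + c , x₂ + t)

Contains : ℕ → ℕ × ℕ × ℕ → (a g : ℕ) → (Fin (suc g) → Vertex) → Set
Contains k (x₁ , x₂ , s) a g σ = (j : Fin (suc g)) → critVertex k x₁ x₂ s (a + toℕ j) ≡ σ j

contains? : ∀ k p a g σ → Dec (Contains k p a g σ)
contains? k (x₁ , x₂ , s) a g σ =
  all? (λ j → ≡-dec _≟ℕ_ (≡-dec _≟ℕ_ _≟ℕ_) (critVertex k x₁ x₂ s (a + toℕ j)) (σ j))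

critIndices : ℕ → List (ℕ × ℕ × ℕ)
critIndices k =
  concatMap (λ x₁ → concatMap (λ x₂ → map (λ s → (x₁ , x₂ , suc s)) (upTo (2 ^ k)))
                              (upTo (2 ^ k * 2 ^ k)))
            (upTo (2 ^ k))

numContaining : ℕ → (a g : ℕ) → (Fin (suc g) → Vertex) → ℕ
numContaining k a g σ = length (filter (λ p → contains? k p a g σ) (critIndices k))

{-# OPTIONS --safe #-}
-- A critical path containing σ has the same first coordinate as σ on every layer a + j
-- (j < g), so two such paths either both take the (1, q_{a+j}) step there or both do not,
-- and with s fixed the start (x₁, x₂) is forced.  Write k = m + n with 2^m ≤ g ≤ 2^(m+1).
-- The low m bits of a layer index i are the high m bits of q_i, so any 2^m consecutive
-- layers contain, for each t < 2^m, a layer whose q-value lies in [t 2^n, t 2^n + 2^n).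
-- For t = ⌈s / 2^n⌉ the path with parameter s does not step at that layer, hence no path
-- with parameter s′ does, i.e. s′ ≤ q_i < s + 2^(n+1).  So at most 2^(n+1) parameters
-- occur, and 2^(n+1) g ≤ 4 r.
module Submission where

open import Data.Bool using (true; false; if_then_else_)
open import Data.Empty using (⊥-elim)
open import Data.Fin using (Fin; zero; suc; toℕ; fromℕ; fromℕ<; inject₁)
open import Data.Fin.Properties using (toℕ-inject₁; toℕ-fromℕ<; toℕ-injective; toℕ<n)
open import Data.List using (List; _∷_; _++_; map; concatMap; applyUpTo; filter; length)
open import Data.List.Properties using (filter-++; length-++)
open import Data.Nat
open import Data.Nat.DivMod
open import Data.Nat.Divisibility using (divides-refl)
open import Data.Nat.Properties
open import Data.Nat.Solver using (module +-*-Solver)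
open import Data.Product using (∃; ∃₂; _×_; _,_; proj₁; proj₂)
open import Data.Product.Properties using (,-injectiveˡ; ,-injectiveʳ)
open import Function using (_∘_; id)
open import Relation.Binary.PropositionalEquality
open import Relation.Nullary using (Dec; yes; no; does)
open import Relation.Unary using (Pred; Decidable)

open import Algebra.Properties.CommutativeMonoid.Sum +-0-commutativeMonoid
  using (sum; sum-syntax; ∑-comm; sum-cong-≗)

open import Defs

bitrev-< : ∀ n i → bitrev n i < 2 ^ n
bitrev-< zero    i = s≤s z≤n
bitrev-< (suc n) i = begin-strict
  i % 2 * 2 ^ n + bitrev n (i / 2) <⟨ +-monoʳ-< (i % 2 * 2 ^ n) (bitrev-< n (i / 2)) ⟩
  i % 2 * 2 ^ n + 2 ^ n            ≤⟨ +-monoˡ-≤ (2 ^ n) (*-monoˡ-≤ (2 ^ n) (s≤s⁻¹ (m%n<n i 2))) ⟩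
  1 * 2 ^ n + 2 ^ n                ≡⟨ cong₂ _+_ (*-identityˡ (2 ^ n)) (sym (+-identityʳ (2 ^ n))) ⟩
  2 ^ suc n                        ∎
  where open ≤-Reasoning

bitrev-+ : ∀ m n u v → u < 2 ^ m → bitrev (m + n) (u + v * 2 ^ m) ≡ bitrev m u * 2 ^ n + bitrev n v
bitrev-+ zero    n zero    v _        = cong (bitrev n) (*-identityʳ v)
bitrev-+ zero    n (suc u) v (s≤s ())
bitrev-+ (suc m) n u       v u<2^[1+m] = begin
  (u + v * 2 ^ suc m) % 2 * 2 ^ (m + n) + bitrev (m + n) ((u + v * 2 ^ suc m) / 2)
    ≡⟨ cong₂ (λ b j → b * 2 ^ (m + n) + bitrev (m + n) j) low-bit high-bits ⟩
  u % 2 * 2 ^ (m + n) + bitrev (m + n) (u / 2 + v * 2 ^ m)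
    ≡⟨ cong₂ (λ p x → u % 2 * p + x) (^-distribˡ-+-* 2 m n) (bitrev-+ m n (u / 2) v u/2<2^m) ⟩
  u % 2 * (2 ^ m * 2 ^ n) + (bitrev m (u / 2) * 2 ^ n + bitrev n v)
    ≡⟨ solve 5 (λ a p q b c → a :* (p :* q) :+ (b :* q :+ c) := (a :* p :+ b) :* q :+ c) refl
             (u % 2) (2 ^ m) (2 ^ n) (bitrev m (u / 2)) (bitrev n v) ⟩
  (u % 2 * 2 ^ m + bitrev m (u / 2)) * 2 ^ n + bitrev n v ∎
  where
  open ≡-Reasoning
  open +-*-Solver
  shape : u + v * 2 ^ suc m ≡ u + v * 2 ^ m * 2
  shape = cong (u +_) (trans (cong (v *_) (*-comm 2 (2 ^ m))) (sym (*-assoc v (2 ^ m) 2)))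
  low-bit : (u + v * 2 ^ suc m) % 2 ≡ u % 2
  low-bit = trans (cong (_% 2) shape) ([m+kn]%n≡m%n u (v * 2 ^ m) 2)
  high-bits : (u + v * 2 ^ suc m) / 2 ≡ u / 2 + v * 2 ^ m
  high-bits = trans (cong (_/ 2) shape)
    (trans (+-distrib-/-∣ʳ u (divides-refl (v * 2 ^ m))) (cong (u / 2 +_) (m*n/n≡m (v * 2 ^ m) 2)))
  u/2<2^m : u / 2 < 2 ^ m
  u/2<2^m = m<n*o⇒m/o<n (subst (u <_) (*-comm 2 (2 ^ m)) u<2^[1+m])

bitrev-surjective : ∀ m t → t < 2 ^ m → ∃ λ u → u < 2 ^ m × bitrev m u ≡ t
bitrev-surjective zero    zero    _         = 0 , s≤s z≤n , refl
bitrev-surjective zero    (suc t) (s≤s ())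
bitrev-surjective (suc m) t t<2^[1+m] with t <? 2 ^ m
... | yes t<2^m
  with u , u<2^m , bitrev-u≡t ← bitrev-surjective m t t<2^m =
  u * 2 ,
  subst (u * 2 <_) (*-comm (2 ^ m) 2) (*-monoˡ-< 2 u<2^m) ,
  trans (cong₂ (λ b j → b * 2 ^ m + bitrev m j) (m*n%n≡0 u 2) (m*n/n≡m u 2)) bitrev-u≡t
... | no  t≮2^m
  with u , u<2^m , bitrev-u≡t ← bitrev-surjective m (t ∸ 2 ^ m) (m<n+o⇒m∸n<o t (2 ^ m) {{m^n≢0 2 m}}
         (subst (t <_) (cong (2 ^ m +_) (+-identityʳ (2 ^ m))) t<2^[1+m])) =
  1 + u * 2 ,
  subst (2 + u * 2 ≤_) (*-comm (2 ^ m) 2) (*-monoˡ-≤ 2 u<2^m) ,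
  (begin
    (1 + u * 2) % 2 * 2 ^ m + bitrev m ((1 + u * 2) / 2)
      ≡⟨ cong₂ (λ b j → b * 2 ^ m + bitrev m j) ([m+kn]%n≡m%n 1 u 2)
               (trans (+-distrib-/-∣ʳ 1 {d = 2} (divides-refl u)) (m*n/n≡m u 2)) ⟩
    1 * 2 ^ m + bitrev m u ≡⟨ cong₂ _+_ (*-identityˡ (2 ^ m)) bitrev-u≡t ⟩
    2 ^ m + (t ∸ 2 ^ m)    ≡⟨ m+[n∸m]≡n (≮⇒≥ t≮2^m) ⟩
    t                      ∎)
  where open ≡-Reasoning

window-contains-residue : ∀ M a u → 0 < M → u < M → ∃ λ c → a ≤ u + c * M × u + c * M < a + M
window-contains-residue M zero    u _   u<M = 0 , z≤n , subst (_< M) (sym (+-identityʳ u)) u<M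
window-contains-residue M (suc a) u 0<M u<M
  with c , a≤i , i<a+M ← window-contains-residue M a u 0<M u<M
  with a ≟ u + c * M
... | no  a≢i = c , ≤∧≢⇒< a≤i a≢i , m<n⇒m<1+n i<a+M
... | yes a≡i = suc c ,
  subst (suc a ≤_) (sym next≡a+M) (m<m+n a 0<M) ,
  subst (_< suc a + M) (sym next≡a+M) (n<1+n (a + M))
  where
  next≡a+M : u + suc c * M ≡ a + M
  next≡a+M = begin
    u + (M + c * M) ≡⟨ cong (u +_) (+-comm M (c * M)) ⟩
    u + (c * M + M) ≡⟨ +-assoc u (c * M) M ⟨
    u + c * M + M   ≡⟨ cong (_+ M) a≡i ⟨
    a + M           ∎
    where open ≡-Reasoning

window-meets-bitrev-block : ∀ m n a t → t < 2 ^ m → ∃ λ i →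
  a ≤ i × i < a + 2 ^ m × t * 2 ^ n ≤ bitrev (m + n) i × bitrev (m + n) i < t * 2 ^ n + 2 ^ n
window-meets-bitrev-block m n a t t<2^m
  with u , u<2^m , bitrev-u≡t ← bitrev-surjective m t t<2^m
  with c , a≤i , i<a+2^m ← window-contains-residue (2 ^ m) a u (m^n>0 2 m) u<2^m
  = u + c * 2 ^ m , a≤i , i<a+2^m ,
    subst (t * 2 ^ n ≤_) (sym block) (m≤m+n (t * 2 ^ n) (bitrev n c)) ,
    subst (_< t * 2 ^ n + 2 ^ n) (sym block) (+-monoʳ-< (t * 2 ^ n) (bitrev-< n c))
  where
  block : bitrev (m + n) (u + c * 2 ^ m) ≡ t * 2 ^ n + bitrev n c
  block = trans (bitrev-+ m n u c u<2^m) (cong (λ x → x * 2 ^ n + bitrev n c) bitrev-u≡t)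

𝟙 : ∀ {p} {P : Set p} → Dec P → ℕ
𝟙 P? = if does P? then 1 else 0

𝟙≤1 : ∀ {p} {P : Set p} (P? : Dec P) → 𝟙 P? ≤ 1
𝟙≤1 (yes _) = s≤s z≤n
𝟙≤1 (no _)  = z≤n

0<𝟙⇒ : ∀ {p} {P : Set p} (P? : Dec P) → 0 < 𝟙 P? → P
0<𝟙⇒ (yes p) _ = p

module _ {a p} {A : Set a} {P : Pred A p} (P? : Decidable P) where

  count : List A → ℕ
  count xs = length (filter P? xs)

  count-∷ : ∀ x xs → count (x ∷ xs) ≡ 𝟙 (P? x) + count xs
  count-∷ x xs with does (P? x)
  ... | true  = refl
  ... | false = refl

  count-++ : ∀ xs ys → count (xs ++ ys) ≡ count xs + count ys
  count-++ xs ys = trans (cong length (filter-++ P? xs ys)) (length-++ (filter P? xs))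

  count-map-applyUpTo : ∀ {b} {B : Set b} (h : B → A) (g : ℕ → B) n →
                        count (map h (applyUpTo g n)) ≡ ∑[ i < n ] 𝟙 (P? (h (g (toℕ i))))
  count-map-applyUpTo h g zero    = refl
  count-map-applyUpTo h g (suc n) =
    trans (count-∷ (h (g 0)) _) (cong (𝟙 (P? (h (g 0))) +_) (count-map-applyUpTo h (g ∘ suc) n))

  count-concatMap-applyUpTo : ∀ {b} {B : Set b} (h : B → List A) (g : ℕ → B) n →
                              count (concatMap h (applyUpTo g n)) ≡ ∑[ i < n ] count (h (g (toℕ i)))
  count-concatMap-applyUpTo h g zero    = refl
  count-concatMap-applyUpTo h g (suc n) =
    trans (count-++ (h (g 0)) _) (cong (count (h (g 0)) +_) (count-concatMap-applyUpTo h (g ∘ suc) n))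

sum-pos : ∀ {n} (f : Fin n → ℕ) → 0 < sum f → ∃ λ i → 0 < f i
sum-pos {suc n} f 0<sum with f zero in f0≡
... | suc _ = zero , subst (0 <_) (sym f0≡) (s≤s z≤n)
... | zero with i , 0<fi ← sum-pos (f ∘ suc) 0<sum = suc i , 0<fi

sum-≤-support-bound : ∀ {n} L (f : Fin n → ℕ) → (∀ i → f i ≤ 1) →
                      (∀ i → 0 < f i → toℕ i < L) → sum f ≤ L
sum-≤-support-bound {zero}  L       f f≤1 supp = z≤n
sum-≤-support-bound {suc n} zero    f f≤1 supp =
  +-mono-≤ (≮⇒≥ (λ 0<f0 → n≮0 (supp zero 0<f0)))
           (sum-≤-support-bound zero (f ∘ suc) (f≤1 ∘ suc)
              (λ i 0<fi → ⊥-elim (n≮0 (supp (suc i) 0<fi))))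
sum-≤-support-bound {suc n} (suc L) f f≤1 supp =
  +-mono-≤ (f≤1 zero) (sum-≤-support-bound L (f ∘ suc) (f≤1 ∘ suc)
                         (λ i 0<fi → s≤s⁻¹ (supp (suc i) 0<fi)))

sum-≤-support-diameter : ∀ {n} D (f : Fin n → ℕ) → (∀ i → f i ≤ 1) →
  (∀ i j → 0 < f i → 0 < f j → toℕ i ≤ toℕ j → toℕ j < toℕ i + D) → sum f ≤ D
sum-≤-support-diameter {zero}  D f f≤1 close = z≤n
sum-≤-support-diameter {suc n} D f f≤1 close with 0 <? f zero
... | yes 0<f0 = sum-≤-support-bound D f f≤1 (λ j 0<fj → close zero j 0<f0 0<fj z≤n)
... | no  0≮f0 = +-mono-≤ (≮⇒≥ 0≮f0) (sum-≤-support-diameter D (f ∘ suc) (f≤1 ∘ suc)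
                   (λ i j 0<fi 0<fj i≤j → s≤s⁻¹ (close (suc i) (suc j) 0<fi 0<fj (s≤s i≤j))))

sum-≤-1 : ∀ {n} (f : Fin n → ℕ) → (∀ i → f i ≤ 1) →
          (∀ i j → 0 < f i → 0 < f j → i ≡ j) → sum f ≤ 1
sum-≤-1 f f≤1 unique = sum-≤-support-diameter 1 f f≤1
  (λ i j 0<fi 0<fj _ →
     subst (λ k → toℕ k < toℕ i + 1) (unique i j 0<fi 0<fj) (m<m+n (toℕ i) (s≤s z≤n)))

module _ {r} {R : ℕ → ℕ → Set r} (R? : ∀ x y → Dec (R x y)) where

  ∑∑𝟙-pos : ∀ N M → 0 < ∑[ x < N ] ∑[ y < M ] 𝟙 (R? (toℕ x) (toℕ y)) → ∃₂ R
  ∑∑𝟙-pos N M 0<sum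
    with x , 0<row ← sum-pos {N} _ 0<sum
    with y , 0<𝟙R ← sum-pos {M} (λ y → 𝟙 (R? (toℕ x) (toℕ y))) 0<row
    = toℕ x , toℕ y , 0<𝟙⇒ (R? _ _) 0<𝟙R

  ∑∑𝟙-≤-1 : ∀ N M → (∀ {x y x′ y′} → R x y → R x′ y′ → x ≡ x′ × y ≡ y′) →
            ∑[ x < N ] ∑[ y < M ] 𝟙 (R? (toℕ x) (toℕ y)) ≤ 1
  ∑∑𝟙-≤-1 N M R-unique = sum-≤-1 {N} row row≤1 rows-unique
    where
    row : Fin N → ℕ
    row x = ∑[ y < M ] 𝟙 (R? (toℕ x) (toℕ y))
    row≤1 : ∀ x → row x ≤ 1
    row≤1 x = sum-≤-1 {M} (λ y → 𝟙 (R? (toℕ x) (toℕ y))) (λ y → 𝟙≤1 (R? _ _))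
      (λ y y′ 0<𝟙R 0<𝟙R′ →
         toℕ-injective (proj₂ (R-unique (0<𝟙⇒ (R? _ _) 0<𝟙R) (0<𝟙⇒ (R? _ _) 0<𝟙R′))))
    rows-unique : ∀ x x′ → 0 < row x → 0 < row x′ → x ≡ x′
    rows-unique x x′ 0<row 0<row′
      with y , 0<𝟙R ← sum-pos {M} (λ y → 𝟙 (R? (toℕ x) (toℕ y))) 0<row
      with y′ , 0<𝟙R′ ← sum-pos {M} (λ y → 𝟙 (R? (toℕ x′) (toℕ y))) 0<row′
      = toℕ-injective (proj₁ (R-unique (0<𝟙⇒ (R? _ _) 0<𝟙R) (0<𝟙⇒ (R? _ _) 0<𝟙R′)))

coord₁ : Vertex → ℕ
coord₁ (_ , x₁ , _) = x₁

critVertex-≡ : ∀ k x₁ x₂ s i →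
               critVertex k x₁ x₂ s i ≡ (i , x₁ + proj₁ (offset k s i) , x₂ + proj₂ (offset k s i))
critVertex-≡ k x₁ x₂ s i with offset k s i
... | _ = refl

offset-step-< : ∀ k s i → q k i < s → proj₁ (offset k s (suc i)) ≡ proj₁ (offset k s i) + 1
offset-step-< k s i q<s with offset k s i | q k i <? s
... | _ | yes _   = refl
... | _ | no  q≮s = ⊥-elim (q≮s q<s)

offset-step-≥ : ∀ k s i → s ≤ q k i → proj₁ (offset k s (suc i)) ≡ proj₁ (offset k s i)
offset-step-≥ k s i s≤q with offset k s i | q k i <? s
... | _ | yes q<s = ⊥-elim (≤⇒≯ s≤q q<s)
... | _ | no  _   = refl

module _ {k a g : ℕ} {σ : Fin (suc g) → Vertex} where

  Contains-coord₁ : ∀ {x₁ x₂ s} → Contains k (x₁ , x₂ , s) a g σ →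
                    ∀ j → coord₁ (σ j) ≡ x₁ + proj₁ (offset k s (a + toℕ j))
  Contains-coord₁ {x₁} {x₂} {s} C j =
    trans (cong coord₁ (sym (C j))) (cong coord₁ (critVertex-≡ k x₁ x₂ s (a + toℕ j)))

  Contains-coord₁-step : ∀ {x₁ x₂ s} → Contains k (x₁ , x₂ , s) a g σ → (j : Fin g) →
    coord₁ (σ (inject₁ j)) ≡ x₁ + proj₁ (offset k s (a + toℕ j)) ×
    coord₁ (σ (suc j)) ≡ x₁ + proj₁ (offset k s (suc (a + toℕ j)))
  Contains-coord₁-step {x₁} {s = s} C j =
    trans (Contains-coord₁ C (inject₁ j)) (cong (λ l → x₁ + proj₁ (offset k s (a + l))) (toℕ-inject₁ j)) ,
    trans (Contains-coord₁ C (suc j)) (cong (λ l → x₁ + proj₁ (offset k s l)) (+-suc a (toℕ j)))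

  Contains-stays-together : ∀ {x₁ x₂ s x₁′ x₂′ s′} →
    Contains k (x₁ , x₂ , s) a g σ → Contains k (x₁′ , x₂′ , s′) a g σ →
    (j : Fin g) → s ≤ q k (a + toℕ j) → s′ ≤ q k (a + toℕ j)
  Contains-stays-together {x₁} {_} {s} {x₁′} {_} {s′} C C′ j s≤q = ≮⇒≥ λ q<s′ → 1+n≢n (begin
    1 + before                                  ≡⟨ +-comm 1 before ⟩
    before + 1                                  ≡⟨ cong (_+ 1) (proj₁ (Contains-coord₁-step C′ j)) ⟩
    x₁′ + proj₁ (offset k s′ i) + 1             ≡⟨ +-assoc x₁′ _ 1 ⟩
    x₁′ + (proj₁ (offset k s′ i) + 1)           ≡⟨ cong (x₁′ +_) (offset-step-< k s′ i q<s′) ⟨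
    x₁′ + proj₁ (offset k s′ (suc i))           ≡⟨ proj₂ (Contains-coord₁-step C′ j) ⟨
    coord₁ (σ (suc j))                          ≡⟨ proj₂ (Contains-coord₁-step C j) ⟩
    x₁ + proj₁ (offset k s (suc i))             ≡⟨ cong (x₁ +_) (offset-step-≥ k s i s≤q) ⟩
    x₁ + proj₁ (offset k s i)                   ≡⟨ proj₁ (Contains-coord₁-step C j) ⟨
    before                                      ∎)
    where
    open ≡-Reasoning
    i = a + toℕ j
    before = coord₁ (σ (inject₁ j))

  Contains-start-unique : ∀ {x₁ x₂ x₁′ x₂′ s} →
    Contains k (x₁ , x₂ , s) a g σ → Contains k (x₁′ , x₂′ , s) a g σ → x₁ ≡ x₁′ × x₂ ≡ x₂′
  Contains-start-unique {x₁} {x₂} {x₁′} {x₂′} {s} C C′ =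
    +-cancelʳ-≡ _ x₁ x₁′ (,-injectiveˡ coords) , +-cancelʳ-≡ _ x₂ x₂′ (,-injectiveʳ coords)
    where
    coords : (x₁ + proj₁ (offset k s (a + 0)) , x₂ + proj₂ (offset k s (a + 0))) ≡
             (x₁′ + proj₁ (offset k s (a + 0)) , x₂′ + proj₂ (offset k s (a + 0)))
    coords = ,-injectiveʳ (trans (sym (critVertex-≡ k x₁ x₂ s (a + 0)))
               (trans (C zero) (trans (sym (C′ zero)) (critVertex-≡ k x₁′ x₂′ s (a + 0)))))

critical-parameters-close : ∀ {m n a g} {σ : Fin (suc g) → Vertex} {x₁ x₂ s x₁′ x₂′ s′} →
  2 ^ m ≤ g →
  Contains (m + n) (x₁ , x₂ , s) a g σ → Contains (m + n) (x₁′ , x₂′ , s′) a g σ →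
  s′ ≤ 2 ^ (m + n) → s′ < s + (2 ^ n + 2 ^ n)
critical-parameters-close {m} {n} {a} {g} {s = s} {s′ = s′} 2^m≤g C C′ s′≤2^[m+n]
  with t , s≤t2^n , t2^n<s+2^n ← window-contains-residue (2 ^ n) s 0 (m^n>0 2 n) (m^n>0 2 n)
  with t <? 2 ^ m
... | no t≮2^m = begin-strict
  s′                  ≤⟨ s′≤2^[m+n] ⟩
  2 ^ (m + n)         ≡⟨ ^-distribˡ-+-* 2 m n ⟩
  2 ^ m * 2 ^ n       ≤⟨ *-monoˡ-≤ (2 ^ n) (≮⇒≥ t≮2^m) ⟩
  t * 2 ^ n           <⟨ t2^n<s+2^n ⟩
  s + 2 ^ n           ≤⟨ +-monoʳ-≤ s (m≤m+n (2 ^ n) (2 ^ n)) ⟩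
  s + (2 ^ n + 2 ^ n) ∎
  where open ≤-Reasoning
... | yes t<2^m
  with i , a≤i , i<a+2^m , t2^n≤qᵢ , qᵢ<t2^n+2^n ← window-meets-bitrev-block m n a t t<2^m = begin-strict
  s′                  ≤⟨ s′≤qᵢ ⟩
  q (m + n) i         <⟨ qᵢ<t2^n+2^n ⟩
  t * 2 ^ n + 2 ^ n   ≤⟨ +-monoˡ-≤ (2 ^ n) (<⇒≤ t2^n<s+2^n) ⟩
  s + 2 ^ n + 2 ^ n   ≡⟨ +-assoc s (2 ^ n) (2 ^ n) ⟩
  s + (2 ^ n + 2 ^ n) ∎
  where
  open ≤-Reasoning
  j : Fin g
  j = fromℕ< (subst (i ∸ a <_) (m+n∸m≡n a g)
                (∸-monoˡ-< (<-≤-trans i<a+2^m (+-monoʳ-≤ a 2^m≤g)) a≤i))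
  a+j≡i : a + toℕ j ≡ i
  a+j≡i = trans (cong (a +_) (toℕ-fromℕ< _)) (m+[n∸m]≡n a≤i)
  s′≤qᵢ : s′ ≤ q (m + n) i
  s′≤qᵢ = subst (λ l → s′ ≤ q (m + n) l) a+j≡i
    (Contains-stays-together C C′ j
      (subst (λ l → s ≤ q (m + n) l) (sym a+j≡i) (≤-trans s≤t2^n t2^n≤qᵢ)))

numContaining-≤ : ∀ m n a g (σ : Fin (suc g) → Vertex) → 2 ^ m ≤ g →
                  numContaining (m + n) a g σ ≤ 2 ^ n + 2 ^ n
numContaining-≤ m n a g σ 2^m≤g = begin
  numContaining k a g σ
    ≡⟨ count-concatMap-applyUpTo contains-σ? column id r ⟩
  ∑[ x < r ] count contains-σ? (column (toℕ x))
    ≡⟨ sum-cong-≗ {r} (λ x →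
         trans (count-concatMap-applyUpTo contains-σ? (cell (toℕ x)) id (r * r))
               (sum-cong-≗ {r * r} (λ y →
                  count-map-applyUpTo contains-σ? (λ s → (toℕ x , toℕ y , suc s)) id r))) ⟩
  ∑[ x < r ] ∑[ y < r * r ] ∑[ s < r ] contained x y s
    ≡⟨ sum-cong-≗ {r} (λ x → ∑-comm (contained x)) ⟩
  ∑[ x < r ] ∑[ s < r ] ∑[ y < r * r ] contained x y s
    ≡⟨ ∑-comm (λ x s → ∑[ y < r * r ] contained x y s) ⟩
  ∑[ s < r ] pathsWith s
    ≤⟨ sum-≤-support-diameter (2 ^ n + 2 ^ n) pathsWith pathsWith≤1 pathsWith-close ⟩
  2 ^ n + 2 ^ n ∎
  where
  open ≤-Reasoning
  k = m + n
  r = 2 ^ k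
  contains-σ? : ∀ p → Dec (Contains k p a g σ)
  contains-σ? p = contains? k p a g σ
  cell : ℕ → ℕ → List (ℕ × ℕ × ℕ)
  cell x y = map (λ s → (x , y , suc s)) (applyUpTo id r)
  column : ℕ → List (ℕ × ℕ × ℕ)
  column x = concatMap (cell x) (applyUpTo id (r * r))
  contained : Fin r → Fin (r * r) → Fin r → ℕ
  contained x y s = 𝟙 (contains-σ? (toℕ x , toℕ y , suc (toℕ s)))
  pathsWith : Fin r → ℕ
  pathsWith s = ∑[ x < r ] ∑[ y < r * r ] contained x y s
  pathsWith≤1 : ∀ s → pathsWith s ≤ 1
  pathsWith≤1 s = ∑∑𝟙-≤-1 (λ x y → contains-σ? (x , y , suc (toℕ s))) r (r * r) Contains-start-unique
  pathsWith-close : ∀ s s′ → 0 < pathsWith s → 0 < pathsWith s′ → toℕ s ≤ toℕ s′ →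
                    toℕ s′ < toℕ s + (2 ^ n + 2 ^ n)
  pathsWith-close s s′ 0<paths 0<paths′ _
    with _ , _ , C  ← ∑∑𝟙-pos (λ x y → contains-σ? (x , y , suc (toℕ s))) r (r * r) 0<paths
    with _ , _ , C′ ← ∑∑𝟙-pos (λ x y → contains-σ? (x , y , suc (toℕ s′))) r (r * r) 0<paths′
    = s≤s⁻¹ (critical-parameters-close {m} {n} 2^m≤g C C′ (toℕ<n s′))

dyadic-bracket : ∀ k g → 1 ≤ g → g ≤ 2 ^ k → ∃₂ λ m n → k ≡ m + n × 2 ^ m ≤ g × g ≤ 2 * 2 ^ m
dyadic-bracket zero    g 1≤g g≤1 = 0 , 0 , refl , 1≤g , ≤-trans g≤1 (s≤s z≤n)
dyadic-bracket (suc k) g 1≤g g≤2^[1+k] with g ≤? 2 ^ k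
... | no  g≰2^k = k , 1 , +-comm 1 k , <⇒≤ (≰⇒> g≰2^k) , g≤2^[1+k]
... | yes g≤2^k with m , n , k≡m+n , bracket ← dyadic-bracket k g 1≤g g≤2^k =
  m , suc n , trans (cong suc k≡m+n) (sym (+-suc m n)) , bracket

lemma4p3 : (k : ℕ) (a b g : ℕ) (σ : Fin (suc g) → Vertex) →
           1 ≤ g → a < 2 ^ k + 1 → b < 2 ^ k + 1 → b ≡ a + g →
           IsPath k g σ → proj₁ (σ zero) ≡ a → proj₁ (σ (fromℕ g)) ≡ b →
           numContaining k a g σ * g ≤ 8 * 2 ^ k
lemma4p3 k a b g σ 1≤g _ b<2^k+1 b≡a+g _ _ _
  with m , n , refl , 2^m≤g , g≤2*2^m ← dyadic-bracket k g 1≤g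
         (m+n≤o⇒n≤o a (subst (_≤ 2 ^ k) b≡a+g (m<1+n⇒m≤n (subst (b <_) (+-comm (2 ^ k) 1) b<2^k+1))))
  = begin
  numContaining (m + n) a g σ * g
    ≤⟨ *-mono-≤ (numContaining-≤ m n a g σ 2^m≤g) g≤2*2^m ⟩
  (2 ^ n + 2 ^ n) * (2 * 2 ^ m)
    ≡⟨ solve 2 (λ M N → (N :+ N) :* (con 2 :* M) := con 4 :* (M :* N)) refl (2 ^ m) (2 ^ n) ⟩
  4 * (2 ^ m * 2 ^ n)
    ≤⟨ *-monoˡ-≤ (2 ^ m * 2 ^ n) (m≤m+n 4 4) ⟩
  8 * (2 ^ m * 2 ^ n)
    ≡⟨ cong (8 *_) (^-distribˡ-+-* 2 m n) ⟨
  8 * 2 ^ (m + n)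
    ∎
  where
  open ≤-Reasoning
  open +-*-Solver
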